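{- The field topology $\tau$ on $K$ is t-henselian if and only if it is gt-henselian and a V-topology.
   Context: $\tau$ is a Hausdorff non-discrete field topology on $K$. $\tau$ is gt-henselian if for every $n$ and every neighbourhood $P$ of $-1$ there is a neighbourhood $O$ of $0$ such that $X^{n+1}+X^n+a_{n-1}X^{n-1}+\dots+a_0$ has a root in $P$ for all $a_0,\dots,a_{n-1}\in O$. $\tau$ is t-henselian if it is a V-topology (in the sense of Prestel–Ziegler) and for every $n\ge1$ there is a neighbourhood $U$ of $0$ such that every polynomial $X^n+X^{n-1}+a_{n-2}X^{n-2}+\dots+a_0$ with $a_{n-2},\dots,a_0\in U$ has a zero in $K$. -}

module Defs where

open import Level using (Level; _⊔_; suc; Lift)
open import Algebra.Bundles using (CommutativeRing)
open import Data.Nat using (ℕ; zero) renaming (suc to sucℕ)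
open import Data.Fin using (Fin) renaming (zero to fzero; suc to fsuc)
open import Data.Product using (Σ; ∃; ∃₂; _×_; _,_)
open import Data.Sum using (_⊎_)
open import Data.Empty using (⊥)
open import Relation.Nullary using (¬_)
open import Relation.Unary using (Pred)

module _ {c ℓ : Level} (R : CommutativeRing c ℓ) where
  open CommutativeRing R

  record IsField : Set (c ⊔ ℓ) where
    field
      1≉0     : ¬ (1# ≈ 0#)
      inverse : ∀ x → ¬ (x ≈ 0#) → ∃ λ y → x * y ≈ 1#

  pow : Carrier → ℕ → Carrier
  pow x zero     = 1#
  pow x (sucℕ n) = x * pow x n

  lowerSum : (m : ℕ) → (Fin m → Carrier) → Carrier → Carrier
  lowerSum zero     a x = 0#
  lowerSum (sucℕ m) a x = a fzero + x * lowerSum m (λ i → a (fsuc i)) x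

  henselPoly : (m : ℕ) → (Fin m → Carrier) → Carrier → Carrier
  henselPoly m a x = pow x (sucℕ m) + pow x m + lowerSum m a x

  Subset : Set (suc (c ⊔ ℓ))
  Subset = Pred Carrier (c ⊔ ℓ)

  record Topology (t : Level) : Set (suc (c ⊔ ℓ ⊔ t)) where
    field
      Nbhd      : Carrier → Subset → Set t
      nbhd-resp : ∀ {x y U} → x ≈ y → Nbhd x U → Nbhd y U
      nbhd-mem  : ∀ {x U} → Nbhd x U → U x
      nbhd-sup  : ∀ {x U V} → (∀ z → U z → V z) → Nbhd x U → Nbhd x V
      nbhd-∩    : ∀ {x U V} → Nbhd x U → Nbhd x V → Nbhd x (λ z → U z × V z)
      nbhd-ex   : ∀ x → ∃ λ U → Nbhd x U
      nbhd-open : ∀ {x U} → Nbhd x U → ∃ λ V → Nbhd x V × (∀ y → V y → Nbhd y U)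

  module _ {t : Level} (τ : Topology t) where
    open Topology τ

    record IsFieldTopology : Set (suc (c ⊔ ℓ) ⊔ t) where
      field
        +-cont : ∀ x y W → Nbhd (x + y) W →
                 ∃₂ λ U V → Nbhd x U × Nbhd y V × (∀ u v → U u → V v → W (u + v))
        *-cont : ∀ x y W → Nbhd (x * y) W →
                 ∃₂ λ U V → Nbhd x U × Nbhd y V × (∀ u v → U u → V v → W (u * v))
        ‐-cont : ∀ x W → Nbhd (- x) W →
                 ∃ λ U → Nbhd x U × (∀ u → U u → W (- u))
        ⁻¹-cont : ∀ x y → x * y ≈ 1# → ∀ W → Nbhd y W →
                  ∃ λ U → Nbhd x U × (∀ u → U u → ¬ (u ≈ 0#) × (∀ v → u * v ≈ 1# → W v))

    IsHausdorff : Set (suc (c ⊔ ℓ) ⊔ t)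
    IsHausdorff = ∀ x y → ¬ (x ≈ y) →
      ∃₂ λ U V → Nbhd x U × Nbhd y V × (∀ z → U z → V z → ⊥)

    IsNonDiscrete : Set (c ⊔ t)
    IsNonDiscrete = ¬ (∀ x → Nbhd x (λ z → Lift c (z ≈ x)))

    IsHNDFieldTopology : Set (suc (c ⊔ ℓ) ⊔ t)
    IsHNDFieldTopology = IsFieldTopology × IsHausdorff × IsNonDiscrete

    IsVTopology : Set (suc (c ⊔ ℓ) ⊔ t)
    IsVTopology = ∀ W → Nbhd 0# W →
      ∃ λ U → Nbhd 0# U × (∀ x y → U (x * y) → W x ⊎ W y)

    IsGtHenselian : Set (suc (c ⊔ ℓ) ⊔ t)
    IsGtHenselian = ∀ (n : ℕ) P → Nbhd (- 1#) P →
      ∃ λ O → Nbhd 0# O × (∀ (a : Fin n → Carrier) → (∀ i → O (a i)) →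
        ∃ λ x → P x × henselPoly n a x ≈ 0#)

    -- t-henselian: V-topology and for every n ≥ 1 (written n = m + 1) there is a
    -- neighbourhood U of 0 such that X^n+X^(n-1)+a_{n-2}X^(n-2)+...+a_0 has a zero in K
    -- whenever all a_i ∈ U.
    IsTHenselian : Set (suc (c ⊔ ℓ) ⊔ t)
    IsTHenselian = IsVTopology × (∀ (m : ℕ) →
      ∃ λ U → Nbhd 0# U × (∀ (a : Fin m → Carrier) → (∀ i → U (a i)) →
        ∃ λ x → henselPoly m a x ≈ 0#))

-- For small coefficients, t-henselianity gives
-- a root x₀ of f = X^(m+2) + X^(m+1) + a_m X^m + ... + a_0, and the V-topology forces every
-- point where f is small to lie near a root −1 or 0 of X^(m+2) + X^(m+1). If x₀ is near −1
-- we are done. If x₀ is near 0, the quotient of f by X − x₀ is X^(m+1) + (x₀ + 1) X^m + ...,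
-- so substituting X = (x₀ + 1) Y and dividing by (x₀ + 1)^(m+1) gives a polynomial of the
-- same shape, one degree lower, whose lower coefficients are small by continuity. By
-- induction it has a root y near −1, and then (x₀ + 1) y is a root of f near −1.
module Submission where

open import Defs
open import Level using (Level; _⊔_) renaming (suc to lsuc)
open import Algebra.Bundles using (CommutativeRing)
open import Data.Nat using (ℕ; zero; suc)
open import Data.Fin using (Fin) renaming (zero to fzero; suc to fsuc)
open import Data.Vec.Functional using (head; tail; _∷_; [])
open import Data.Product using (∃; _×_; _,_; proj₁; proj₂)
open import Data.Sum using (_⊎_; inj₁; inj₂; [_,_]′)
open import Function.Base using (_∘_)
open import Function.Bundles using (_⇔_; mk⇔)

module HenselPolynomial {ℓ₁ ℓ₂ : Level} (K : CommutativeRing ℓ₁ ℓ₂) where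
  open CommutativeRing K
  open import Relation.Binary.Reasoning.Setoid setoid
  open import Algebra.Solver.Ring.NaturalCoefficients.Default commutativeSemiring
    using (solve; _:=_; _:+_; _:*_; con)

  henselPoly-suc : ∀ m a x →
    henselPoly K (suc m) a x ≈ head a + x * henselPoly K m (tail a) x
  henselPoly-suc m a x =
    solve 4 (λ x p a₀ s → x :* (x :* p) :+ x :* p :+ (a₀ :+ x :* s)
                          := a₀ :+ x :* (x :* p :+ p :+ s))
      refl x (pow K x m) (head a) (lowerSum K m (tail a) x)

  quotient : (n : ℕ) → (Fin n → Carrier) → Carrier → Carrier → Carrier
  quotient zero    a x₀ X = 1#
  quotient (suc n) a x₀ X = henselPoly K n (tail a) x₀ + X * quotient n (tail a) x₀ X

  -- Moving x₀ · quotient to the left keeps the factor theorem a semiring identity.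
  henselPoly-factor : ∀ n a x₀ X →
    henselPoly K n a X + x₀ * quotient n a x₀ X ≈ henselPoly K n a x₀ + X * quotient n a x₀ X
  henselPoly-factor zero a x₀ X =
    solve 2 (λ X x₀ → X :* con 1 :+ con 1 :+ con 0 :+ x₀ :* con 1
                      := x₀ :* con 1 :+ con 1 :+ con 0 :+ X :* con 1) refl X x₀
  henselPoly-factor (suc n) a x₀ X = begin
    henselPoly K (suc n) a X + x₀ * (F x₀ + X * Q)
      ≈⟨ +-congʳ (henselPoly-suc n a X) ⟩
    head a + X * F X + x₀ * (F x₀ + X * Q)
      ≈⟨ solve 6 (λ a₀ X x₀ FX Fx₀ Q → a₀ :+ X :* FX :+ x₀ :* (Fx₀ :+ X :* Q)
                                      := a₀ :+ x₀ :* Fx₀ :+ X :* (FX :+ x₀ :* Q))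
           refl (head a) X x₀ (F X) (F x₀) Q ⟩
    head a + x₀ * F x₀ + X * (F X + x₀ * Q)
      ≈⟨ +-congˡ (*-congˡ (henselPoly-factor n (tail a) x₀ X)) ⟩
    head a + x₀ * F x₀ + X * (F x₀ + X * Q)
      ≈⟨ +-congʳ (sym (henselPoly-suc n a x₀)) ⟩
    henselPoly K (suc n) a x₀ + X * (F x₀ + X * Q) ∎
    where
      F : Carrier → Carrier
      F = henselPoly K n (tail a)
      Q : Carrier
      Q = quotient n (tail a) x₀ X

  pow-inverse : ∀ {u v} → u * v ≈ 1# → ∀ k → pow K u k * pow K v k ≈ 1#
  pow-inverse uv zero    = *-identityʳ 1#
  pow-inverse {u} {v} uv (suc k) = begin
    u * pow K u k * (v * pow K v k)
      ≈⟨ solve 4 (λ u p v q → u :* p :* (v :* q) := u :* v :* (p :* q))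
           refl u (pow K u k) v (pow K v k) ⟩
    u * v * (pow K u k * pow K v k) ≈⟨ *-cong uv (pow-inverse uv k) ⟩
    1# * 1#                         ≈⟨ *-identityʳ 1# ⟩
    1#                              ∎

  -- d plays the role of (x₀ + 1)⁻¹.
  rescaledCoeffs : Carrier → Carrier → (m : ℕ) → (Fin (suc m) → Carrier) → Fin m → Carrier
  rescaledCoeffs x₀ d zero    a = []
  rescaledCoeffs x₀ d (suc m) a =
    henselPoly K (suc m) (tail a) x₀ * pow K d (suc (suc m)) ∷ rescaledCoeffs x₀ d m (tail a)

  quotient-rescale : ∀ {x₀ d} → (x₀ + 1#) * d ≈ 1# → ∀ m a y →
    quotient (suc m) a x₀ ((x₀ + 1#) * y)
      ≈ pow K (x₀ + 1#) (suc m) * henselPoly K m (rescaledCoeffs x₀ d m a) y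
  quotient-rescale {x₀} cd zero a y =
    solve 2 (λ x₀ y → x₀ :* con 1 :+ con 1 :+ con 0 :+ (x₀ :+ con 1) :* y :* con 1
                      := (x₀ :+ con 1) :* con 1 :* (y :* con 1 :+ con 1 :+ con 0)) refl x₀ y
  quotient-rescale {x₀} {d} cd (suc m) a y = begin
    F₀ + c * y * quotient (suc m) (tail a) x₀ (c * y)
      ≈⟨ +-congˡ (*-congˡ (quotient-rescale cd m (tail a) y)) ⟩
    F₀ + c * y * (p * H)
      ≈⟨ +-congʳ (sym (trans (*-congʳ (pow-inverse cd (suc (suc m)))) (*-identityˡ F₀))) ⟩
    c * p * q * F₀ + c * y * (p * H)
      ≈⟨ solve 6 (λ c p q F₀ y H → c :* p :* q :* F₀ :+ c :* y :* (p :* H)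
                                   := c :* p :* (F₀ :* q :+ y :* H)) refl c p q F₀ y H ⟩
    c * p * (F₀ * q + y * H)
      ≈⟨ *-congˡ (sym (henselPoly-suc m (rescaledCoeffs x₀ d (suc m) a) y)) ⟩
    c * p * henselPoly K (suc m) (rescaledCoeffs x₀ d (suc m) a) y ∎
    where
      c F₀ p q H : Carrier
      c = x₀ + 1#
      F₀ = henselPoly K (suc m) (tail a) x₀
      p = pow K c (suc m)
      q = pow K d (suc (suc m))
      H = henselPoly K m (rescaledCoeffs x₀ d m (tail a)) y

  henselPoly-rescaledRoot : ∀ {x₀ d} → (x₀ + 1#) * d ≈ 1# → ∀ m a y →
    henselPoly K (suc m) a x₀ ≈ 0# → henselPoly K m (rescaledCoeffs x₀ d m a) y ≈ 0# →
    henselPoly K (suc m) a ((x₀ + 1#) * y) ≈ 0#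
  henselPoly-rescaledRoot {x₀} {d} cd m a y fx₀≈0 gy≈0 = begin
    f (c * y)              ≈⟨ +-identityʳ (f (c * y)) ⟨
    f (c * y) + 0#         ≈⟨ +-congˡ (trans (*-congˡ Q≈0) (zeroʳ x₀)) ⟨
    f (c * y) + x₀ * Q     ≈⟨ henselPoly-factor (suc m) a x₀ (c * y) ⟩
    f x₀ + c * y * Q       ≈⟨ +-cong fx₀≈0 (trans (*-congˡ Q≈0) (zeroʳ (c * y))) ⟩
    0# + 0#                ≈⟨ +-identityʳ 0# ⟩
    0#                     ∎
    where
      c Q : Carrier
      c = x₀ + 1#
      Q = quotient (suc m) a x₀ (c * y)
      f : Carrier → Carrier
      f = henselPoly K (suc m) a
      Q≈0 : Q ≈ 0#
      Q≈0 = trans (quotient-rescale cd m a y) (trans (*-congˡ gy≈0) (zeroʳ _))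

module Neighbourhoods {ℓ₁ ℓ₂ t : Level} (K : CommutativeRing ℓ₁ ℓ₂)
                      (τ : Topology K t) (FT : IsFieldTopology K τ) where
  open CommutativeRing K
  open Topology τ
  open IsFieldTopology FT

  ∈-nbhd-≈ : ∀ {x y U} → Nbhd x U → x ≈ y → U y
  ∈-nbhd-≈ N x≈y = nbhd-mem (nbhd-resp x≈y N)

  -- Subsets are not assumed to respect ≈; this recovers enough of that for a neighbourhood.
  ≈-closed-subnbhd : ∀ {x U} → Nbhd x U →
    ∃ λ V → Nbhd x V × (∀ {y z} → V y → y ≈ z → U z)
  ≈-closed-subnbhd N with nbhd-open N
  ... | V , NV , V⊆int = V , NV , λ Vy y≈z → ∈-nbhd-≈ (V⊆int _ Vy) y≈z

  ForSmall : ∀ {q} (n : ℕ) → ((Fin n → Carrier) → Set q) → Set (lsuc (ℓ₁ ⊔ ℓ₂) ⊔ t ⊔ q)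
  ForSmall n Q = ∃ λ O → Nbhd 0# O × (∀ a → (∀ i → O (a i)) → Q a)

  forSmall-always : ∀ {q n} {Q : (Fin n → Carrier) → Set q} → (∀ a → Q a) → ForSmall n Q
  forSmall-always Qa = proj₁ (nbhd-ex 0#) , proj₂ (nbhd-ex 0#) , λ a _ → Qa a

  module _ {q r} {n : ℕ} {Q : (Fin n → Carrier) → Set q} {R : (Fin n → Carrier) → Set r} where

    forSmall-map : (∀ a → Q a → R a) → ForSmall n Q → ForSmall n R
    forSmall-map Q⇒R (O , NO , Q-small) = O , NO , λ a small → Q⇒R a (Q-small a small)

    forSmall-× : ForSmall n Q → ForSmall n R → ForSmall n (λ a → Q a × R a)
    forSmall-× (O , NO , Q-small) (O′ , NO′ , R-small) =
      (λ z → O z × O′ z) , nbhd-∩ NO NO′ ,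
      λ a small → Q-small a (proj₁ ∘ small) , R-small a (proj₂ ∘ small)

  forSmall-tail : ∀ {q n} {Q : (Fin n → Carrier) → Set q} →
                  ForSmall n Q → ForSmall (suc n) (λ a → Q (tail a))
  forSmall-tail (O , NO , Q-small) = O , NO , λ a small → Q-small (tail a) (small ∘ fsuc)

  forSmall-head : ∀ {n O} → Nbhd 0# O → ForSmall (suc n) (λ a → O (head a))
  forSmall-head {O = O} NO = O , NO , λ a small → small fzero

  ForSmallNear : ∀ {q} (n : ℕ) → Carrier → ((Fin n → Carrier) → Carrier → Set q) →
                 Set (lsuc (ℓ₁ ⊔ ℓ₂) ⊔ t ⊔ q)
  ForSmallNear n p Q = ∃ λ X → Nbhd p X × ForSmall n (λ a → ∀ x → X x → Q a x)

  forSmallNear-× : ∀ {q r n p} {Q : (Fin n → Carrier) → Carrier → Set q}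
                   {R : (Fin n → Carrier) → Carrier → Set r} →
                   ForSmallNear n p Q → ForSmallNear n p R →
                   ForSmallNear n p (λ a x → Q a x × R a x)
  forSmallNear-× (X , NX , Q-small) (X′ , NX′ , R-small) =
    (λ z → X z × X′ z) , nbhd-∩ NX NX′ ,
    forSmall-map (λ a (Q-near , R-near) x (Xx , X′x) → Q-near x Xx , R-near x X′x)
                 (forSmall-× Q-small R-small)

  ContinuousAt₀ : (n : ℕ) → Carrier → ((Fin n → Carrier) → Carrier → Carrier) →
                  Set (lsuc (ℓ₁ ⊔ ℓ₂) ⊔ t)
  ContinuousAt₀ n p F = ∀ T → Nbhd (F (λ _ → 0#) p) T → ForSmallNear n p (λ a x → T (F a x))

  module _ {n : ℕ} {p : Carrier} where

    continuousAt₀-const : ∀ z → ContinuousAt₀ n p (λ _ _ → z)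
    continuousAt₀-const z T Tz =
      proj₁ (nbhd-ex p) , proj₂ (nbhd-ex p) , forSmall-always (λ _ _ _ → nbhd-mem Tz)

    continuousAt₀-var : ContinuousAt₀ n p (λ _ x → x)
    continuousAt₀-var T Tp = T , Tp , forSmall-always (λ _ _ Tx → Tx)

    continuousAt₀-head : ContinuousAt₀ (suc n) p (λ a _ → head a)
    continuousAt₀-head T T0 =
      proj₁ (nbhd-ex p) , proj₂ (nbhd-ex p) , forSmall-map (λ _ T-head _ _ → T-head) (forSmall-head T0)

    continuousAt₀-tail : ∀ {F} → ContinuousAt₀ n p F → ContinuousAt₀ (suc n) p (λ a → F (tail a))
    continuousAt₀-tail F-cont T TF with F-cont T TF
    ... | X , NX , F-small = X , NX , forSmall-tail F-small

    continuousAt₀-+ : ∀ {F G} → ContinuousAt₀ n p F → ContinuousAt₀ n p G →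
                      ContinuousAt₀ n p (λ a x → F a x + G a x)
    continuousAt₀-+ {F} {G} F-cont G-cont T T[F+G]
      with +-cont (F (λ _ → 0#) p) (G (λ _ → 0#) p) T T[F+G]
    ... | U , V , NU , NV , U+V⊆T with forSmallNear-× (F-cont U NU) (G-cont V NV)
    ... | X , NX , small =
      X , NX , forSmall-map (λ a UV x Xx → U+V⊆T _ _ (proj₁ (UV x Xx)) (proj₂ (UV x Xx))) small

    continuousAt₀-* : ∀ {F G} → ContinuousAt₀ n p F → ContinuousAt₀ n p G →
                      ContinuousAt₀ n p (λ a x → F a x * G a x)
    continuousAt₀-* {F} {G} F-cont G-cont T T[F*G]
      with *-cont (F (λ _ → 0#) p) (G (λ _ → 0#) p) T T[F*G]
    ... | U , V , NU , NV , U*V⊆T with forSmallNear-× (F-cont U NU) (G-cont V NV)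
    ... | X , NX , small =
      X , NX , forSmall-map (λ a UV x Xx → U*V⊆T _ _ (proj₁ (UV x Xx)) (proj₂ (UV x Xx))) small

  pow-continuousAt₀ : ∀ {n p} e → ContinuousAt₀ n p (λ _ x → pow K x e)
  pow-continuousAt₀ zero    = continuousAt₀-const 1#
  pow-continuousAt₀ (suc e) = continuousAt₀-* continuousAt₀-var (pow-continuousAt₀ e)

  pow-nbhd : ∀ {p T} e → Nbhd (pow K p e) T → Nbhd p (λ x → T (pow K x e))
  pow-nbhd {p} e Tpe with pow-continuousAt₀ {n = 0} {p} e _ Tpe
  ... | X , NX , _ , _ , near = nbhd-sup (near (λ ()) (λ ())) NX

  lowerSum-continuousAt₀ : ∀ n {p} → ContinuousAt₀ n p (lowerSum K n)
  lowerSum-continuousAt₀ zero    = continuousAt₀-const 0#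
  lowerSum-continuousAt₀ (suc n) =
    continuousAt₀-+ continuousAt₀-head
      (continuousAt₀-* continuousAt₀-var (continuousAt₀-tail (lowerSum-continuousAt₀ n)))

  henselPoly-continuousAt₀ : ∀ n {p} → ContinuousAt₀ n p (henselPoly K n)
  henselPoly-continuousAt₀ n =
    continuousAt₀-+ (continuousAt₀-+ (pow-continuousAt₀ (suc n)) (pow-continuousAt₀ n))
                    (lowerSum-continuousAt₀ n)

module Henselianity {ℓ₁ ℓ₂ t : Level} (K : CommutativeRing ℓ₁ ℓ₂) (isField : IsField K)
                    (τ : Topology K t) (FT : IsFieldTopology K τ) where
  open CommutativeRing K
  open IsField isField
  open Topology τ
  open IsFieldTopology FT
  open HenselPolynomial K
  open Neighbourhoods K τ FT
  open import Relation.Binary.Reasoning.Setoid setoid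
  open import Algebra.Properties.AbelianGroup +-abelianGroup using (xyx⁻¹≈y)

  shift-nbhd : ∀ {C} → Nbhd 1# C → Nbhd 0# (λ x₀ → C (x₀ + 1#))
  shift-nbhd NC with +-cont 0# 1# _ (nbhd-resp (sym (+-identityˡ 1#)) NC)
  ... | U , V , NU , NV , U+V⊆C = nbhd-sup (λ x₀ Ux₀ → U+V⊆C x₀ 1# Ux₀ (nbhd-mem NV)) NU

  shift-inverse-nbhd : ∀ {D} → Nbhd 1# D → Nbhd 0# (λ x₀ → ∃ λ d → (x₀ + 1#) * d ≈ 1# × D d)
  shift-inverse-nbhd {D} ND with ⁻¹-cont 1# 1# (*-identityˡ 1#) D ND
  ... | U , NU , U⁻¹⊆D = shift-nbhd (nbhd-sup invertible NU)
    where
      invertible : ∀ u → U u → ∃ λ d → u * d ≈ 1# × D d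
      invertible u Uu with inverse u (proj₁ (U⁻¹⊆D u Uu))
      ... | d , ud≈1 = d , ud≈1 , proj₂ (U⁻¹⊆D u Uu) d ud≈1

  difference-nbhd : ∀ {U} → Nbhd 0# U →
    ∃ λ E → Nbhd 0# E × Nbhd 0# (λ a₀ → ∀ e → E e → U (e + - a₀))
  difference-nbhd {U} NU with +-cont 0# (- 0#) U (nbhd-resp (sym (-‿inverseʳ 0#)) NU)
  ... | E , V , NE , NV , E+V⊆U with ‐-cont 0# V NV
  ... | A , NA , -A⊆V = E , NE , nbhd-sup (λ a₀ Aa₀ e Ee → E+V⊆U e (- a₀) Ee (-A⊆V a₀ Aa₀)) NA

  henselPoly-suc-0≈0 : ∀ k → henselPoly K (suc k) (λ _ → 0#) 0# ≈ 0#
  henselPoly-suc-0≈0 k = begin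
    0# * pow K 0# (suc k) + 0# * pow K 0# k + (0# + 0# * lowerSum K k (λ _ → 0#) 0#)
      ≈⟨ +-cong (+-cong (zeroˡ _) (zeroˡ _)) (+-congˡ (zeroˡ _)) ⟩
    0# + 0# + (0# + 0#) ≈⟨ +-cong (+-identityʳ 0#) (+-identityʳ 0#) ⟩
    0# + 0#             ≈⟨ +-identityʳ 0# ⟩
    0#                  ∎

  rescaledHead-small : ∀ {O : Subset K} k e → Nbhd 0# O →
    ∃ λ W → ∃ λ D → Nbhd 0# W × Nbhd 1# D ×
      ForSmall (suc k) (λ b → ∀ x₀ d → W x₀ → D d → O (henselPoly K (suc k) b x₀ * pow K d e))
  rescaledHead-small {O} k e NO
    with *-cont _ (pow K 1# e) O
           (nbhd-resp (sym (trans (*-congʳ (henselPoly-suc-0≈0 k)) (zeroˡ _))) NO)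
  ... | U , V , NU , NV , U*V⊆O with henselPoly-continuousAt₀ (suc k) U NU
  ... | W , NW , near =
    W , (λ d → V (pow K d e)) , NW , pow-nbhd e NV ,
    forSmall-map (λ b Ub x₀ d Wx₀ Vd → U*V⊆O _ _ (Ub x₀ Wx₀) Vd) near

  rescaledCoeffs-small : ∀ {O : Subset K} m → Nbhd 0# O →
    ∃ λ W → ∃ λ D → Nbhd 0# W × Nbhd 1# D ×
      ForSmall (suc m) (λ a → ∀ x₀ d → W x₀ → D d → ∀ j → O (rescaledCoeffs x₀ d m a j))
  rescaledCoeffs-small zero NO =
    proj₁ (nbhd-ex 0#) , proj₁ (nbhd-ex 1#) , proj₂ (nbhd-ex 0#) , proj₂ (nbhd-ex 1#) ,
    forSmall-always (λ _ _ _ _ _ ())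
  rescaledCoeffs-small (suc m) NO =
    let W , D , NW , ND , head-small = rescaledHead-small m (suc (suc m)) NO
        W′ , D′ , NW′ , ND′ , tail-small = rescaledCoeffs-small m NO
    in  (λ x₀ → W x₀ × W′ x₀) , (λ d → D d × D′ d) , nbhd-∩ NW NW′ , nbhd-∩ ND ND′ ,
        forSmall-map (λ a (head-in , tail-in) x₀ d (Wx₀ , W′x₀) (Dd , D′d) → λ where
                        fzero    → head-in x₀ d Wx₀ Dd
                        (fsuc j) → tail-in x₀ d W′x₀ D′d j)
                     (forSmall-tail (forSmall-× head-small tail-small))

  x+1+-1≈x : ∀ x → henselPoly K 0 [] x + - 1# ≈ x
  x+1+-1≈x x = trans (+-congʳ (trans (+-identityʳ _) (trans (+-congʳ (*-identityʳ x)) (+-comm x 1#))))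
                     (xyx⁻¹≈y 1# x)

  henselPoly-suc-head : ∀ n a x → henselPoly K (suc n) a x + - head a ≈ x * henselPoly K n (tail a) x
  henselPoly-suc-head n a x =
    trans (+-congʳ (henselPoly-suc n a x)) (xyx⁻¹≈y (head a) (x * henselPoly K n (tail a) x))

  small-henselPoly⇒near-roots : IsVTopology K τ → ∀ n {P W} → Nbhd (- 1#) P → Nbhd 0# W →
    ∃ λ E → Nbhd 0# E × ForSmall n (λ a → ∀ x → E (henselPoly K n a x) → P x ⊎ W x)
  small-henselPoly⇒near-roots isV zero NP NW
    with ≈-closed-subnbhd NP
  ... | P° , NP° , P°⊆P with +-cont 0# (- 1#) P° (nbhd-resp (sym (+-identityˡ (- 1#))) NP°)
  ... | E , V , NE , NV , E+V⊆P° =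
    E , NE , forSmall-always λ a x Ex →
      inj₁ (P°⊆P (E+V⊆P° _ (- 1#) Ex (nbhd-mem NV)) (x+1+-1≈x x))
  small-henselPoly⇒near-roots isV (suc n) {P} {W} NP NW
    with small-henselPoly⇒near-roots isV n NP NW
  ... | E′ , NE′ , near with isV (λ z → W z × E′ z) (nbhd-∩ NW NE′)
  ... | U , NU , split with ≈-closed-subnbhd NU
  ... | U° , NU° , U°⊆U with difference-nbhd NU°
  ... | E , NE , NA = E , NE , forSmall-map step (forSmall-× (forSmall-head NA) (forSmall-tail near))
    where
      step : ∀ a → (∀ e → E e → U° (e + - head a)) ×
                   (∀ x → E′ (henselPoly K n (tail a) x) → P x ⊎ W x) →
             ∀ x → E (henselPoly K (suc n) a x) → P x ⊎ W x
      step a (sub , near-tail) x Ef =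
        [ inj₂ ∘ proj₁ , near-tail x ∘ proj₂ ]′
          (split x (henselPoly K n (tail a) x) (U°⊆U (sub _ Ef) (henselPoly-suc-head n a x)))

  rootNear0⇒rootIn : ∀ m {P C P′ : Subset K} → Nbhd 1# C → (∀ u y → C u → P′ y → P (u * y)) →
    ForSmall m (λ b → ∃ λ y → P′ y × henselPoly K m b y ≈ 0#) →
    ∃ λ W → Nbhd 0# W × ForSmall (suc m) (λ a → ∀ x₀ → W x₀ → henselPoly K (suc m) a x₀ ≈ 0# →
                                                  ∃ λ x → P x × henselPoly K (suc m) a x ≈ 0#)
  rootNear0⇒rootIn m {P} {C} NC C*P′⊆P (O , NO , roots) with rescaledCoeffs-small m NO
  ... | W , D , NW , ND , small =
    (λ x₀ → W x₀ × C (x₀ + 1#) × ∃ λ d → (x₀ + 1#) * d ≈ 1# × D d) ,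
    nbhd-∩ NW (nbhd-∩ (shift-nbhd NC) (shift-inverse-nbhd ND)) ,
    forSmall-map lift small
    where
      lift : ∀ a → (∀ x₀ d → W x₀ → D d → ∀ j → O (rescaledCoeffs x₀ d m a j)) →
             ∀ x₀ → W x₀ × C (x₀ + 1#) × (∃ λ d → (x₀ + 1#) * d ≈ 1# × D d) →
             henselPoly K (suc m) a x₀ ≈ 0# → ∃ λ x → P x × henselPoly K (suc m) a x ≈ 0#
      lift a small-a x₀ (Wx₀ , Cx₀+1 , d , inverse-d , Dd) root
        with roots (rescaledCoeffs x₀ d m a) (small-a x₀ d Wx₀ Dd)
      ... | y , P′y , root′ =
        (x₀ + 1#) * y , C*P′⊆P _ y Cx₀+1 P′y , henselPoly-rescaledRoot inverse-d m a y root root′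

  gtHenselian-suc : IsVTopology K τ → ∀ m →
    ForSmall (suc m) (λ a → ∃ λ x → henselPoly K (suc m) a x ≈ 0#) →
    (∀ P → Nbhd (- 1#) P → ForSmall m (λ a → ∃ λ x → P x × henselPoly K m a x ≈ 0#)) →
    ∀ P → Nbhd (- 1#) P → ForSmall (suc m) (λ a → ∃ λ x → P x × henselPoly K (suc m) a x ≈ 0#)
  gtHenselian-suc isV m roots rootsIn P NP =
    let C , P′ , NC , NP′ , C*P′⊆P = *-cont 1# (- 1#) P (nbhd-resp (sym (*-identityˡ (- 1#))) NP)
        W , NW , trade = rootNear0⇒rootIn m NC C*P′⊆P (rootsIn P′ NP′)
        E , NE , near = small-henselPoly⇒near-roots isV (suc m) NP NW
    in  forSmall-map (λ a ((x₀ , root) , near-a , trade-a) →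
                       [ (λ Px₀ → x₀ , Px₀ , root) , (λ Wx₀ → trade-a x₀ Wx₀ root) ]′
                         (near-a x₀ (∈-nbhd-≈ NE (sym root))))
                     (forSmall-× roots (forSmall-× near trade))

  roots⇒gtHenselian : IsVTopology K τ →
    (∀ m → ForSmall m (λ a → ∃ λ x → henselPoly K m a x ≈ 0#)) → IsGtHenselian K τ
  roots⇒gtHenselian isV roots zero P NP =
    forSmall-always λ a → - 1# , nbhd-mem NP ,
      trans (+-identityʳ _) (trans (+-congʳ (*-identityʳ (- 1#))) (-‿inverseˡ 1#))
  roots⇒gtHenselian isV roots (suc m) =
    gtHenselian-suc isV m (roots (suc m)) (roots⇒gtHenselian isV roots m)

proposition8p3 : {c ℓ t : Level} (K : CommutativeRing c ℓ) → IsField K →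
    (τ : Topology K t) → IsHNDFieldTopology K τ →
    IsTHenselian K τ ⇔ (IsGtHenselian K τ × IsVTopology K τ)
proposition8p3 K isField τ (FT , _ , _) = mk⇔
  (λ (isV , roots) → roots⇒gtHenselian isV roots , isV)
  (λ (gtHenselian , isV) → isV , λ m → forSmall-map (λ a (x , _ , root) → x , root)
                                         (gtHenselian m _ (proj₂ (nbhd-ex (- 1#)))))
  where
    open CommutativeRing K
    open Topology τ
    open Neighbourhoods K τ FT
    open Henselianity K isField τ FT
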